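{- For every finite graph $G$, the residual graph $R(G)$ is unique up to isomorphism, i.e. every maximal sequence of removals of pendant $P_2$'s starting from $G$ ends in isomorphic graphs.
   Context: All graphs are finite and simple. A pendant $P_2$ in a graph is a path $xy$ attached to the rest of the graph by a single edge, i.e. $x$ has degree $1$, its unique neighbor $y$ has degree $2$, and $y$ has exactly one other neighbor $z$; removing the pendant $P_2$ deletes $x$ and $y$ (two vertices and the two edges $xy$, $yz$). If the current graph is itself $P_2$, it may also be removed, leaving the empty graph. The residual graph $R(G)$ is the graph obtained from $G$ by iteratively removing pendant $P_2$'s until no such path is present. -}

module Defs where

open import Data.Nat using (ℕ; zero; suc)
open import Data.Fin using (Fin; zero; suc; punchIn)
open import Data.Bool using (Bool; true; false)
open import Data.Sum using (_⊎_)
open import Data.Product using (Σ)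
open import Relation.Nullary using (¬_)
open import Relation.Binary.PropositionalEquality using (_≡_; _≢_; refl)
open import Function.Bundles using (_↔_; Inverse)

record Graph (n : ℕ) : Set where
  field
    adj    : Fin n → Fin n → Bool
    sym    : ∀ i j → adj i j ≡ adj j i
    irrefl : ∀ i → adj i i ≡ false
open Graph public

emptyGraph : Graph 0
emptyGraph = record { adj = λ () ; sym = λ () ; irrefl = λ () }

delete : ∀ {n} → Fin (suc n) → Graph (suc n) → Graph n
delete x G = record
  { adj    = λ i j → adj G (punchIn x i) (punchIn x j)
  ; sym    = λ i j → sym G (punchIn x i) (punchIn x j)
  ; irrefl = λ i → irrefl G (punchIn x i) }

record IsPendantP2 {n : ℕ} (G : Graph n) (x y z : Fin n) : Set where
  field
    xy    : adj G x y ≡ true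
    xonly : ∀ w → adj G x w ≡ true → w ≡ y
    yz    : adj G y z ≡ true
    z≢x   : z ≢ x
    yonly : ∀ w → adj G y w ≡ true → (w ≡ x) ⊎ (w ≡ z)

data Step : {n m : ℕ} → Graph n → Graph m → Set where
  -- remove a pendant P2 x y (y written as punchIn x y', i.e. y ≠ x);
  -- result: delete x, then delete y (whose index is y' after deleting x)
  pendant : ∀ {n} (G : Graph (suc (suc n))) (x : Fin (suc (suc n)))
              (y' : Fin (suc n)) (z : Fin (suc (suc n))) →
            IsPendantP2 G x (punchIn x y') z →
            Step G (delete y' (delete x G))
  wholeP2 : (G : Graph 2) → adj G zero (suc zero) ≡ true → Step G emptyGraph

data Steps : {n m : ℕ} → Graph n → Graph m → Set where
  done : ∀ {n} (G : Graph n) → Steps G G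
  next : ∀ {n m k} {G : Graph n} {H : Graph m} {K : Graph k} →
         Step G H → Steps H K → Steps G K

Terminal : ∀ {n} → Graph n → Set
Terminal H = ∀ m (H' : Graph m) → ¬ Step H H'

Iso : ∀ {n m} → Graph n → Graph m → Set
Iso {n} {m} G H =
  Σ (Fin n ↔ Fin m) λ f →
    ∀ i j → adj G i j ≡ adj H (Inverse.to f i) (Inverse.to f j)

module Submission where

open import Defs hiding (sym)
open import Data.Nat using (zero; suc)
open import Data.Fin using (Fin; zero; suc; punchIn; punchOut; _≟_)
open import Data.Fin.Properties using (punchIn-injective; punchInᵢ≢i; punchIn-punchOut)
open import Data.Fin.Permutation
  using (Permutation; _⟨$⟩ʳ_; _⟨$⟩ˡ_; inverseˡ; inverseʳ; id; flip; _∘ₚ_; transpose; ↔⇒≡; permutation)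
import Data.Fin.Permutation.Components as PC
open import Data.Bool using (true)
open import Data.Bool.Properties using (¬-not)
open import Data.List using (List; []; _∷_; map)
open import Data.List.Membership.Propositional using (_∈_; _∉_)
open import Data.List.Membership.Propositional.Properties using (∈-map⁺; ∈-map⁻)
open import Data.List.Relation.Unary.Any using (here; there)
open import Data.List.Relation.Binary.Permutation.Propositional using (_↭_; ↭-sym; ↭-refl; swap)
open import Data.List.Relation.Binary.Permutation.Propositional.Properties using (∈-resp-↭; ++-comm)
open import Data.Empty using (⊥-elim)
open import Data.Sum using (inj₁; inj₂)
open import Data.Product using (∃; ∃₂; _×_; _,_; proj₁; proj₂)
open import Function using (_∘_)
open import Relation.Nullary using (¬_; yes; no; contradiction)
open import Relation.Binary.PropositionalEquality

-- Any two steps can be completed, by at most one further step each, to isomorphic graphs.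
-- For pendant P2's x₁y₁ and x₂y₂ of G the results are already isomorphic when the leaves
-- coincide, when the stems coincide (swap the two leaves), or when x₁y₁y₂x₂ is a path
-- component (pass through G − {x₁, x₂}); otherwise the two paths are disjoint, each survives
-- the removal of the other, and both orders delete the same four vertices. As steps
-- transport along isomorphisms, a step and a maximal sequence from the same graph can be
-- joined (the strip lemma, by induction on the sequence), and uniqueness follows by
-- induction on the other sequence.

adj⇒≢ : ∀ {n} (G : Graph n) {u v} → adj G u v ≡ true → u ≢ v
adj⇒≢ G {u} uv refl with trans (sym uv) (irrefl G u)
... | ()

adj-sym : ∀ {n} (G : Graph n) {u v} → adj G u v ≡ true → adj G v u ≡ true
adj-sym G {u} {v} uv = trans (Graph.sym G v u) uv

same-neighbours : ∀ {n} (G : Graph n) {p q r t : Fin n} → adj G p t ≡ true → adj G q t ≡ true →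
                  (∀ {w} → w ≢ r → adj G p w ≡ true → w ≡ t) →
                  (∀ {w} → w ≢ r → adj G q w ≡ true → w ≡ t) →
                  ∀ {w} → w ≢ r → adj G p w ≡ adj G q w
same-neighbours G {t = t} pt qt p-only q-only {w} w≢r with w ≟ t
... | yes refl = trans pt (sym qt)
... | no w≢t   = trans (¬-not (w≢t ∘ p-only w≢r)) (sym (¬-not (w≢t ∘ q-only w≢r)))

∉-pair : ∀ {n} {v a b : Fin n} → v ≢ a → v ≢ b → v ∉ a ∷ b ∷ []
∉-pair v≢a v≢b (here v≡a)         = v≢a v≡a
∉-pair v≢a v≢b (there (here v≡b)) = v≢b v≡b

⟨$⟩ʳ-injective : ∀ {n m} (π : Permutation n m) {u v} → π ⟨$⟩ʳ u ≡ π ⟨$⟩ʳ v → u ≡ v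
⟨$⟩ʳ-injective π {u} {v} eq = begin
  u                      ≡⟨ inverseˡ π ⟨
  π ⟨$⟩ˡ (π ⟨$⟩ʳ u)      ≡⟨ cong (π ⟨$⟩ˡ_) eq ⟩
  π ⟨$⟩ˡ (π ⟨$⟩ʳ v)      ≡⟨ inverseˡ π ⟩
  v                      ∎
  where open ≡-Reasoning

transpose-matchʳ : ∀ {n} {i j : Fin n} → i ≢ j → PC.transpose i j j ≡ i
transpose-matchʳ {i = i} {j} i≢j with j ≟ i
... | yes j≡i = contradiction (sym j≡i) i≢j
... | no _ with j ≟ j
...   | yes _   = refl
...   | no j≢j = contradiction refl j≢j

transpose-other : ∀ {n} {i j k : Fin n} → k ≢ i → k ≢ j → PC.transpose i j k ≡ k
transpose-other {i = i} {j} {k} k≢i k≢j with k ≟ i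
... | yes k≡i = contradiction k≡i k≢i
... | no _ with k ≟ j
...   | yes k≡j = contradiction k≡j k≢j
...   | no _    = refl

-- Iso unfolds to a Σ-type, so its graph arguments cannot be inferred from it; several call
-- sites below therefore give them explicitly.
Iso-refl : ∀ {n} {G : Graph n} → Iso G G
Iso-refl = id , λ _ _ → refl

Iso-sym : ∀ {n m} {G : Graph n} {H : Graph m} → Iso G H → Iso H G
Iso-sym {G = G} {H} (π , π-adj) = flip π , λ i j → begin
  adj H i j                                     ≡⟨ cong₂ (adj H) (inverseʳ π) (inverseʳ π) ⟨
  adj H (π ⟨$⟩ʳ (π ⟨$⟩ˡ i)) (π ⟨$⟩ʳ (π ⟨$⟩ˡ j)) ≡⟨ π-adj _ _ ⟨
  adj G (π ⟨$⟩ˡ i) (π ⟨$⟩ˡ j)                   ∎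
  where open ≡-Reasoning

Iso-trans : ∀ {n m k} {G : Graph n} {H : Graph m} {K : Graph k} → Iso G H → Iso H K → Iso G K
Iso-trans (π , π-adj) (ρ , ρ-adj) = π ∘ₚ ρ , λ i j → trans (π-adj i j) (ρ-adj _ _)

-- Induced subgraphs

record _↪_ {m n} (H : Graph m) (G : Graph n) : Set where
  field
    vertex           : Fin m → Fin n
    vertex-injective : ∀ {i j} → vertex i ≡ vertex j → i ≡ j
    adj-vertex       : ∀ i j → adj H i j ≡ adj G (vertex i) (vertex j)
open _↪_

↪-refl : ∀ {n} {G : Graph n} → G ↪ G
↪-refl = record { vertex = λ i → i ; vertex-injective = λ eq → eq ; adj-vertex = λ _ _ → refl }

↪-delete : ∀ {m n} {A : Graph (suc m)} {G : Graph n} (x : Fin (suc m)) → A ↪ G → delete x A ↪ G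
↪-delete x E = record
  { vertex           = vertex E ∘ punchIn x
  ; vertex-injective = punchIn-injective x _ _ ∘ vertex-injective E
  ; adj-vertex       = λ i j → adj-vertex E (punchIn x i) (punchIn x j)
  }

Iso⇒↪ : ∀ {n m} {G : Graph n} {H : Graph m} → Iso G H → G ↪ H
Iso⇒↪ (π , π-adj) = record
  { vertex = π ⟨$⟩ʳ_ ; vertex-injective = ⟨$⟩ʳ-injective π ; adj-vertex = π-adj }

open IsPendantP2

IsPendantP2-reflect : ∀ {m n} {H : Graph m} {G : Graph n} (E : H ↪ G) {a b c x y z} →
                      vertex E a ≡ x → vertex E b ≡ y → vertex E c ≡ z →
                      IsPendantP2 G x y z → IsPendantP2 H a b c
IsPendantP2-reflect E {a} {b} {c} refl refl refl p = record
  { xy    = trans (adj-vertex E a b) (xy p)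
  ; xonly = λ w aw → vertex-injective E (xonly p _ (trans (sym (adj-vertex E a w)) aw))
  ; yz    = trans (adj-vertex E b c) (yz p)
  ; z≢x   = z≢x p ∘ cong (vertex E)
  ; yonly = λ w bw → Data.Sum.map (vertex-injective E) (vertex-injective E)
                       (yonly p _ (trans (sym (adj-vertex E b w)) bw))
  }

-- E embeds H as the subgraph of G induced on the vertices outside vs.
record Removes {m n} {H : Graph m} {G : Graph n} (E : H ↪ G) (vs : List (Fin n)) : Set where
  field
    image-avoids : ∀ i → vertex E i ∉ vs
    image-covers : ∀ {v} → v ∉ vs → ∃ λ i → vertex E i ≡ v
open Removes

Removes-refl : ∀ {n} {G : Graph n} → Removes (↪-refl {G = G}) []
Removes-refl = record { image-avoids = λ _ () ; image-covers = λ {v} _ → v , refl }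

Removes-delete : ∀ {m n} {A : Graph (suc m)} {G : Graph n} {E : A ↪ G} {vs} (x : Fin (suc m)) →
                 Removes E vs → Removes (↪-delete x E) (vertex E x ∷ vs)
Removes-delete {E = E} {vs} x R = record { image-avoids = avoids ; image-covers = covers }
  where
  avoids : ∀ i → vertex E (punchIn x i) ∉ vertex E x ∷ vs
  avoids i (here eq)  = punchInᵢ≢i x i (vertex-injective E eq)
  avoids i (there v∈) = image-avoids R (punchIn x i) v∈
  covers : ∀ {v} → v ∉ vertex E x ∷ vs → ∃ λ i → vertex E (punchIn x i) ≡ v
  covers {v} v∉ with image-covers R (v∉ ∘ there)
  ... | u , Eu≡v = punchOut x≢u , trans (cong (vertex E) (punchIn-punchOut x≢u)) Eu≡v
    where
    x≢u : x ≢ u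
    x≢u x≡u = v∉ (here (trans (sym Eu≡v) (cong (vertex E) (sym x≡u))))

Removes-resp-↭ : ∀ {m n} {H : Graph m} {G : Graph n} {E : H ↪ G} {vs ws} →
                 vs ↭ ws → Removes E vs → Removes E ws
Removes-resp-↭ vs↭ws R = record
  { image-avoids = λ i → image-avoids R i ∘ ∈-resp-↭ (↭-sym vs↭ws)
  ; image-covers = λ v∉ → image-covers R (v∉ ∘ ∈-resp-↭ vs↭ws)
  }

Removes-delete-delete : ∀ {n} {G : Graph (suc (suc n))} (x : Fin (suc (suc n))) (a : Fin (suc n)) →
                        Removes (↪-delete a (↪-delete x (↪-refl {G = G}))) (punchIn x a ∷ x ∷ [])
Removes-delete-delete x a = Removes-delete a (Removes-delete x Removes-refl)

delete-pair : ∀ {n} (G : Graph n) {u v : Fin n} → u ≢ v →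
              ∃₂ λ k (H : Graph k) → ∃ λ (E : H ↪ G) → Removes E (v ∷ u ∷ [])
delete-pair {suc zero}    G {zero} {zero} u≢v = contradiction refl u≢v
delete-pair {suc (suc n)} G {u}           u≢v =
  _ , _ , _ , subst (λ w → Removes (↪-delete (punchOut u≢v) (↪-delete u ↪-refl)) (w ∷ u ∷ []))
                    (punchIn-punchOut u≢v) (Removes-delete-delete u (punchOut u≢v))

Removes⇒Iso : ∀ {m₁ m₂ n₁ n₂} {H₁ : Graph m₁} {H₂ : Graph m₂} {G₁ : Graph n₁} {G₂ : Graph n₂}
              {E₁ : H₁ ↪ G₁} {E₂ : H₂ ↪ G₂} {vs₁ vs₂} →
              Removes E₁ vs₁ → Removes E₂ vs₂ → (π : Permutation n₁ n₂) →
              (∀ {v} → v ∉ vs₁ → π ⟨$⟩ʳ v ∉ vs₂) → (∀ {w} → w ∉ vs₂ → π ⟨$⟩ˡ w ∉ vs₁) →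
              (∀ {u v} → u ∉ vs₁ → v ∉ vs₁ → adj G₂ (π ⟨$⟩ʳ u) (π ⟨$⟩ʳ v) ≡ adj G₁ u v) →
              Iso H₁ H₂
Removes⇒Iso {m₁} {m₂} {H₁ = H₁} {H₂} {G₁} {G₂} {E₁} {E₂} R₁ R₂ π maps unmaps π-adj =
  permutation to from to-from from-to , to-adj
  where
  open ≡-Reasoning
  covered₂ : ∀ i → ∃ λ j → vertex E₂ j ≡ π ⟨$⟩ʳ vertex E₁ i
  covered₂ i = image-covers R₂ (maps (image-avoids R₁ i))
  covered₁ : ∀ j → ∃ λ i → vertex E₁ i ≡ π ⟨$⟩ˡ vertex E₂ j
  covered₁ j = image-covers R₁ (unmaps (image-avoids R₂ j))
  to : Fin m₁ → Fin m₂
  to i = proj₁ (covered₂ i)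
  from : Fin m₂ → Fin m₁
  from j = proj₁ (covered₁ j)
  to-from : ∀ j → to (from j) ≡ j
  to-from j = vertex-injective E₂ (begin
    vertex E₂ (to (from j))           ≡⟨ proj₂ (covered₂ (from j)) ⟩
    π ⟨$⟩ʳ vertex E₁ (from j)          ≡⟨ cong (π ⟨$⟩ʳ_) (proj₂ (covered₁ j)) ⟩
    π ⟨$⟩ʳ (π ⟨$⟩ˡ vertex E₂ j)        ≡⟨ inverseʳ π ⟩
    vertex E₂ j                        ∎)
  from-to : ∀ i → from (to i) ≡ i
  from-to i = vertex-injective E₁ (begin
    vertex E₁ (from (to i))           ≡⟨ proj₂ (covered₁ (to i)) ⟩
    π ⟨$⟩ˡ vertex E₂ (to i)            ≡⟨ cong (π ⟨$⟩ˡ_) (proj₂ (covered₂ i)) ⟩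
    π ⟨$⟩ˡ (π ⟨$⟩ʳ vertex E₁ i)        ≡⟨ inverseˡ π ⟩
    vertex E₁ i                        ∎)
  to-adj : ∀ i j → adj H₁ i j ≡ adj H₂ (to i) (to j)
  to-adj i j = begin
    adj H₁ i j                                           ≡⟨ adj-vertex E₁ i j ⟩
    adj G₁ (vertex E₁ i) (vertex E₁ j)                   ≡⟨ π-adj (image-avoids R₁ i) (image-avoids R₁ j) ⟨
    adj G₂ (π ⟨$⟩ʳ vertex E₁ i) (π ⟨$⟩ʳ vertex E₁ j)     ≡⟨ cong₂ (adj G₂) (proj₂ (covered₂ i))
                                                                          (proj₂ (covered₂ j)) ⟨
    adj G₂ (vertex E₂ (to i)) (vertex E₂ (to j))         ≡⟨ adj-vertex E₂ (to i) (to j) ⟨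
    adj H₂ (to i) (to j)                                 ∎

Removes-same⇒Iso : ∀ {m₁ m₂ n} {H₁ : Graph m₁} {H₂ : Graph m₂} {G : Graph n}
                   {E₁ : H₁ ↪ G} {E₂ : H₂ ↪ G} {vs} → Removes E₁ vs → Removes E₂ vs → Iso H₁ H₂
Removes-same⇒Iso R₁ R₂ = Removes⇒Iso R₁ R₂ id (λ v∉ → v∉) (λ w∉ → w∉) (λ _ _ → refl)

Removes-map⇒Iso : ∀ {m₁ m₂ n₁ n₂} {H₁ : Graph m₁} {H₂ : Graph m₂} {G₁ : Graph n₁} {G₂ : Graph n₂}
                  {E₁ : H₁ ↪ G₁} {E₂ : H₂ ↪ G₂} {vs} ((π , _) : Iso G₁ G₂) →
                  Removes E₁ vs → Removes E₂ (map (π ⟨$⟩ʳ_) vs) → Iso H₁ H₂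
Removes-map⇒Iso {vs = vs} (π , π-adj) R₁ R₂ = Removes⇒Iso R₁ R₂ π maps unmaps (λ _ _ → sym (π-adj _ _))
  where
  maps : ∀ {v} → v ∉ vs → π ⟨$⟩ʳ v ∉ map (π ⟨$⟩ʳ_) vs
  maps v∉ πv∈ with ∈-map⁻ (π ⟨$⟩ʳ_) πv∈
  ... | u , u∈ , πv≡πu = v∉ (subst (_∈ vs) (sym (⟨$⟩ʳ-injective π πv≡πu)) u∈)
  unmaps : ∀ {w} → w ∉ map (π ⟨$⟩ʳ_) vs → π ⟨$⟩ˡ w ∉ vs
  unmaps w∉ π⁻¹w∈ = w∉ (subst (_∈ map (π ⟨$⟩ʳ_) vs) (inverseʳ π) (∈-map⁺ (π ⟨$⟩ʳ_) π⁻¹w∈))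

Removes-twins⇒Iso : ∀ {m₁ m₂ n} {H₁ : Graph m₁} {H₂ : Graph m₂} {G : Graph n}
                    {E₁ : H₁ ↪ G} {E₂ : H₂ ↪ G} {p q r} → p ≢ q → p ≢ r → q ≢ r →
                    (∀ {w} → w ≢ p → w ≢ q → w ≢ r → adj G p w ≡ adj G q w) →
                    Removes E₁ (p ∷ r ∷ []) → Removes E₂ (q ∷ r ∷ []) → Iso H₁ H₂
Removes-twins⇒Iso {G = G} {p = p} {q} {r} p≢q p≢r q≢r twins R₁ R₂ =
  Removes⇒Iso R₁ R₂ (transpose p q) (transpose-∉ p≢q p≢r) (transpose-∉ (≢-sym p≢q) q≢r) transpose-adj
  where
  transpose-∉ : ∀ {a b v} → a ≢ b → a ≢ r → v ∉ a ∷ r ∷ [] → PC.transpose a b v ∉ b ∷ r ∷ []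
  transpose-∉ {a} {b} {v} a≢b a≢r v∉ with v ≟ b
  ... | yes refl rewrite transpose-matchʳ a≢b = ∉-pair a≢b a≢r
  ... | no v≢b rewrite transpose-other (v∉ ∘ here) v≢b = ∉-pair v≢b (v∉ ∘ there ∘ here)
  twins′ : ∀ {w} → w ∉ p ∷ r ∷ [] → w ≢ q → adj G p w ≡ adj G q w
  twins′ w∉ w≢q = twins (w∉ ∘ here) w≢q (w∉ ∘ there ∘ here)
  transpose-adj : ∀ {u v} → u ∉ p ∷ r ∷ [] → v ∉ p ∷ r ∷ [] →
                  adj G (PC.transpose p q u) (PC.transpose p q v) ≡ adj G u v
  transpose-adj {u} {v} u∉ v∉ with u ≟ q | v ≟ q
  ... | yes refl | yes refl rewrite transpose-matchʳ p≢q = trans (irrefl G p) (sym (irrefl G q))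
  ... | yes refl | no v≢q
    rewrite transpose-matchʳ p≢q | transpose-other (v∉ ∘ here) v≢q = twins′ v∉ v≢q
  ... | no u≢q | yes refl
    rewrite transpose-matchʳ p≢q | transpose-other (u∉ ∘ here) u≢q =
      trans (Graph.sym G u p) (trans (twins′ u∉ u≢q) (Graph.sym G q u))
  ... | no u≢q | no v≢q
    rewrite transpose-other (u∉ ∘ here) u≢q | transpose-other (v∉ ∘ here) v≢q = refl

-- Transport of steps along isomorphisms

Graph₂-adj : (G : Graph 2) → adj G zero (suc zero) ≡ true → ∀ {u v} → u ≢ v → adj G u v ≡ true
Graph₂-adj G g₀₁ {zero}     {zero}     u≢v = contradiction refl u≢v
Graph₂-adj G g₀₁ {zero}     {suc zero} _   = g₀₁
Graph₂-adj G g₀₁ {suc zero} {zero}     _   = adj-sym G g₀₁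
Graph₂-adj G g₀₁ {suc zero} {suc zero} u≢v = contradiction refl u≢v

IsPendantP2-Iso : ∀ {n m} {G : Graph n} {H : Graph m} (f : Iso G H) {x y z} → IsPendantP2 G x y z →
                  let π = proj₁ f in IsPendantP2 H (π ⟨$⟩ʳ x) (π ⟨$⟩ʳ y) (π ⟨$⟩ʳ z)
IsPendantP2-Iso {G = G} {H} f@(π , _) =
  IsPendantP2-reflect (Iso⇒↪ (Iso-sym {G = G} {H} f)) (inverseˡ π) (inverseˡ π) (inverseˡ π)

step-transport : ∀ {n m n′} {G : Graph n} {H : Graph m} {G′ : Graph n′} → Iso G G′ → Step G H →
                 ∃₂ λ m′ (H′ : Graph m′) → Step G′ H′ × Iso H H′
step-transport {G′ = G′} f@(π , _) (pendant {k} G x a z p) with ↔⇒≡ π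
... | refl = _ , _ , pendant G′ (π ⟨$⟩ʳ x) a′ (π ⟨$⟩ʳ z) p′ ,
             Removes-map⇒Iso {G₁ = G} {G₂ = G′} f (Removes-delete-delete x a) R′
  where
  πx≢πy : π ⟨$⟩ʳ x ≢ π ⟨$⟩ʳ punchIn x a
  πx≢πy = punchInᵢ≢i x a ∘ sym ∘ ⟨$⟩ʳ-injective π
  a′ : Fin (suc k)
  a′ = punchOut πx≢πy
  πx[a′]≡πy : punchIn (π ⟨$⟩ʳ x) a′ ≡ π ⟨$⟩ʳ punchIn x a
  πx[a′]≡πy = punchIn-punchOut πx≢πy
  p′ : IsPendantP2 G′ (π ⟨$⟩ʳ x) (punchIn (π ⟨$⟩ʳ x) a′) (π ⟨$⟩ʳ z)
  p′ = subst (λ y → IsPendantP2 G′ (π ⟨$⟩ʳ x) y (π ⟨$⟩ʳ z)) (sym πx[a′]≡πy) (IsPendantP2-Iso f p)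
  E′ : delete a′ (delete (π ⟨$⟩ʳ x) G′) ↪ G′
  E′ = ↪-delete a′ (↪-delete (π ⟨$⟩ʳ x) ↪-refl)
  R′ : Removes E′ ((π ⟨$⟩ʳ punchIn x a) ∷ (π ⟨$⟩ʳ x) ∷ [])
  R′ = subst (λ y → Removes E′ (y ∷ (π ⟨$⟩ʳ x) ∷ [])) πx[a′]≡πy (Removes-delete-delete (π ⟨$⟩ʳ x) a′)
step-transport {G′ = G′} f@(π , _) (wholeP2 G g₀₁) with ↔⇒≡ π
... | refl = _ , _ , wholeP2 G′ g′₀₁ , Iso-refl {G = emptyGraph}
  where
  g′₀₁ : adj G′ zero (suc zero) ≡ true
  g′₀₁ = trans (proj₂ (Iso-sym {G = G} {G′} f) zero (suc zero))
               (Graph₂-adj G g₀₁ ((λ ()) ∘ ⟨$⟩ʳ-injective (flip π)))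

steps-transport : ∀ {n m n′} {G : Graph n} {H : Graph m} {G′ : Graph n′} → Iso G G′ → Steps G H →
                  ∃₂ λ m′ (H′ : Graph m′) → Steps G′ H′ × Iso H H′
steps-transport f (done _) = _ , _ , done _ , f
steps-transport f (next s ss) with step-transport f s
... | _ , _ , s′ , g with steps-transport g ss
...   | _ , _ , ss′ , h = _ , _ , next s′ ss′ , h

Terminal-transport : ∀ {n m} {H : Graph n} {H′ : Graph m} → Iso H H′ → Terminal H → Terminal H′
Terminal-transport {H = H} {H′} f t _ _ s′ with step-transport (Iso-sym {G = H} {H′} f) s′
... | _ , _ , s , _ = t _ _ s

-- Two pendant P2's of one graph

module _ {n} {G : Graph n} {x₁ y₁ z₁ x₂ y₂ z₂ : Fin n}
         (p₁ : IsPendantP2 G x₁ y₁ z₁) (p₂ : IsPendantP2 G x₂ y₂ z₂) where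

  leaf≢stem : x₁ ≢ y₂
  leaf≢stem refl = z≢x p₂ (trans (xonly p₁ _ (yz p₂)) (sym (xonly p₁ _ (adj-sym G (xy p₂)))))

  anchor≢leaf : y₁ ≢ y₂ → z₂ ≢ x₁
  anchor≢leaf y₁≢y₂ refl = y₁≢y₂ (sym (xonly p₁ _ (adj-sym G (yz p₂))))

  anchor≢stem : x₁ ≢ y₂ → z₁ ≢ y₂ → z₂ ≢ y₁
  anchor≢stem x₁≢y₂ z₁≢y₂ refl with yonly p₁ y₂ (adj-sym G (yz p₂))
  ... | inj₁ y₂≡x₁ = x₁≢y₂ (sym y₂≡x₁)
  ... | inj₂ y₂≡z₁ = z₁≢y₂ (sym y₂≡z₁)

data Joinable {m₁ m₂} (A₁ : Graph m₁) (A₂ : Graph m₂) : Set where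
  isomorphic : Iso A₁ A₂ → Joinable A₁ A₂
  joined     : ∀ {k₁ k₂} {B₁ : Graph k₁} {B₂ : Graph k₂} →
               Step A₁ B₁ → Step A₂ B₂ → Iso B₁ B₂ → Joinable A₁ A₂

pendant-step : ∀ {m n} {H : Graph m} {G : Graph n} {E : H ↪ G} {vs} → Removes E vs →
               ∀ {a b c} → IsPendantP2 H a b c →
               ∃₂ λ k (K : Graph k) → Step H K × ∃ λ (EK : K ↪ G) →
                 Removes EK (vertex E b ∷ vertex E a ∷ vs)
pendant-step {suc zero}    {H = H} R {zero} {zero} p = contradiction refl (adj⇒≢ H (xy p))
pendant-step {suc (suc m)} {H = H} {E = E} {vs} R {a} {b} {c} p =
  _ , _ , pendant H a b′ c (subst (λ y → IsPendantP2 H a y c) (sym a[b′]≡b) p) , _ ,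
  subst (λ y → Removes (↪-delete b′ (↪-delete a E)) (vertex E y ∷ vertex E a ∷ vs)) a[b′]≡b
        (Removes-delete b′ (Removes-delete a R))
  where
  a≢b : a ≢ b
  a≢b = adj⇒≢ H (xy p)
  b′ : Fin (suc m)
  b′ = punchOut a≢b
  a[b′]≡b : punchIn a b′ ≡ b
  a[b′]≡b = punchIn-punchOut a≢b

module _ {m₁ m₂ n} {G : Graph n} {H₁ : Graph m₁} {H₂ : Graph m₂} {E₁ : H₁ ↪ G} {E₂ : H₂ ↪ G}
         {x₁ y₁ z₁ x₂ y₂ z₂ : Fin n}
         (p₁ : IsPendantP2 G x₁ y₁ z₁) (p₂ : IsPendantP2 G x₂ y₂ z₂)
         (R₁ : Removes E₁ (y₁ ∷ x₁ ∷ [])) (R₂ : Removes E₂ (y₂ ∷ x₂ ∷ [])) where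

  Iso-same-leaf : x₁ ≡ x₂ → Iso H₁ H₂
  Iso-same-leaf refl with xonly p₁ _ (xy p₂)
  ... | refl = Removes-same⇒Iso R₁ R₂

  Iso-same-stem : x₁ ≢ x₂ → y₁ ≡ y₂ → Iso H₁ H₂
  Iso-same-stem x₁≢x₂ refl =
    Removes-twins⇒Iso x₁≢x₂ (adj⇒≢ G (xy p₁)) (adj⇒≢ G (xy p₂))
      (λ _ _ → same-neighbours G (xy p₁) (xy p₂) (λ _ → xonly p₁ _) (λ _ → xonly p₂ _))
      (Removes-resp-↭ (swap _ _ ↭-refl) R₁) (Removes-resp-↭ (swap _ _ ↭-refl) R₂)

  -- Then x₁y₁y₂x₂ is a path component of G, and both sides are isomorphic to G − {x₁, x₂}.
  Iso-stems-adjacent : x₁ ≢ x₂ → z₁ ≡ y₂ → Iso H₁ H₂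
  Iso-stems-adjacent x₁≢x₂ refl with delete-pair G x₁≢x₂
  ... | _ , D , _ , R = Iso-trans {G = H₁} {H = D} {K = H₂}
    (Removes-twins⇒Iso (≢-sym x₂≢y₁) (≢-sym (adj⇒≢ G (xy p₁))) (≢-sym x₁≢x₂)
      (λ _ _ → same-neighbours G (yz p₁) (xy p₂) y₁-only (λ _ → xonly p₂ _)) R₁ R)
    (Removes-twins⇒Iso (leaf≢stem p₁ p₂) x₁≢x₂ (≢-sym (adj⇒≢ G (xy p₂)))
      (λ _ _ → same-neighbours G (xy p₁) (adj-sym G (yz p₁)) (λ _ → xonly p₁ _) y₂-only)
      (Removes-resp-↭ (swap _ _ ↭-refl) R) R₂)
    where
    x₂≢y₁ : x₂ ≢ y₁
    x₂≢y₁ = leaf≢stem p₂ p₁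
    y₁-only : ∀ {w} → w ≢ x₁ → adj G y₁ w ≡ true → w ≡ y₂
    y₁-only w≢x₁ y₁w with yonly p₁ _ y₁w
    ... | inj₁ w≡x₁ = contradiction w≡x₁ w≢x₁
    ... | inj₂ w≡y₂ = w≡y₂
    y₂-only : ∀ {w} → w ≢ x₂ → adj G y₂ w ≡ true → w ≡ y₁
    y₂-only w≢x₂ y₂w with yonly p₂ _ y₂w | yonly p₂ _ (adj-sym G (yz p₁))
    ... | inj₁ w≡x₂ | _          = contradiction w≡x₂ w≢x₂
    ... | inj₂ _    | inj₁ y₁≡x₂ = contradiction (sym y₁≡x₂) x₂≢y₁
    ... | inj₂ w≡z₂ | inj₂ y₁≡z₂ = trans w≡z₂ (sym y₁≡z₂)

  pendant-step-beside : x₁ ≢ x₂ → y₁ ≢ y₂ → z₂ ≢ y₁ →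
                        ∃₂ λ k (K : Graph k) → Step H₁ K × ∃ λ (E : K ↪ G) →
                          Removes E (y₂ ∷ x₂ ∷ y₁ ∷ x₁ ∷ [])
  pendant-step-beside x₁≢x₂ y₁≢y₂ z₂≢y₁
    with image-covers R₁ (∉-pair (leaf≢stem p₂ p₁) (≢-sym x₁≢x₂))
       | image-covers R₁ (∉-pair (≢-sym y₁≢y₂) (≢-sym (leaf≢stem p₁ p₂)))
       | image-covers R₁ (∉-pair z₂≢y₁ (anchor≢leaf p₁ p₂ y₁≢y₂))
  ... | _ , refl | _ , refl | _ , refl = pendant-step R₁ (IsPendantP2-reflect E₁ refl refl refl p₂)

joinable-disjoint : ∀ {m₁ m₂ n} {G : Graph n} {H₁ : Graph m₁} {H₂ : Graph m₂}
                    {E₁ : H₁ ↪ G} {E₂ : H₂ ↪ G} {x₁ y₁ z₁ x₂ y₂ z₂ : Fin n} →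
                    IsPendantP2 G x₁ y₁ z₁ → IsPendantP2 G x₂ y₂ z₂ →
                    Removes E₁ (y₁ ∷ x₁ ∷ []) → Removes E₂ (y₂ ∷ x₂ ∷ []) →
                    x₁ ≢ x₂ → y₁ ≢ y₂ → z₁ ≢ y₂ → Joinable H₁ H₂
joinable-disjoint {x₁ = x₁} {y₁} {x₂ = x₂} {y₂} p₁ p₂ R₁ R₂ x₁≢x₂ y₁≢y₂ z₁≢y₂
  with pendant-step-beside p₁ p₂ R₁ R₂ x₁≢x₂ y₁≢y₂ (anchor≢stem p₁ p₂ (leaf≢stem p₁ p₂) z₁≢y₂)
     | pendant-step-beside p₂ p₁ R₂ R₁ (≢-sym x₁≢x₂) (≢-sym y₁≢y₂) z₁≢y₂
... | _ , _ , s₁ , _ , S₁ | _ , _ , s₂ , _ , S₂ =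
  joined s₁ s₂ (Removes-same⇒Iso S₁ (Removes-resp-↭ (++-comm (y₁ ∷ x₁ ∷ []) (y₂ ∷ x₂ ∷ [])) S₂))

pendants-joinable : ∀ {m₁ m₂ n} {G : Graph n} {H₁ : Graph m₁} {H₂ : Graph m₂}
                    {E₁ : H₁ ↪ G} {E₂ : H₂ ↪ G} {x₁ y₁ z₁ x₂ y₂ z₂ : Fin n} →
                    IsPendantP2 G x₁ y₁ z₁ → IsPendantP2 G x₂ y₂ z₂ →
                    Removes E₁ (y₁ ∷ x₁ ∷ []) → Removes E₂ (y₂ ∷ x₂ ∷ []) → Joinable H₁ H₂
pendants-joinable {x₁ = x₁} {y₁} {z₁} {x₂} {y₂} p₁ p₂ R₁ R₂ with x₁ ≟ x₂ | y₁ ≟ y₂ | z₁ ≟ y₂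
... | yes x₁≡x₂ | _         | _         = isomorphic (Iso-same-leaf p₁ p₂ R₁ R₂ x₁≡x₂)
... | no x₁≢x₂  | yes y₁≡y₂ | _         = isomorphic (Iso-same-stem p₁ p₂ R₁ R₂ x₁≢x₂ y₁≡y₂)
... | no x₁≢x₂  | no _      | yes z₁≡y₂ = isomorphic (Iso-stems-adjacent p₁ p₂ R₁ R₂ x₁≢x₂ z₁≡y₂)
... | no x₁≢x₂  | no y₁≢y₂  | no z₁≢y₂  = joinable-disjoint p₁ p₂ R₁ R₂ x₁≢x₂ y₁≢y₂ z₁≢y₂

Graph₂-no-pendantP2 : (G : Graph 2) (x : Fin 2) (a : Fin 1) (z : Fin 2) →
                      ¬ IsPendantP2 G x (punchIn x a) z
Graph₂-no-pendantP2 G zero       zero zero       p = z≢x p refl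
Graph₂-no-pendantP2 G zero       zero (suc zero) p = adj⇒≢ G (yz p) refl
Graph₂-no-pendantP2 G (suc zero) zero zero       p = adj⇒≢ G (yz p) refl
Graph₂-no-pendantP2 G (suc zero) zero (suc zero) p = z≢x p refl

local-diamond : ∀ {n m₁ m₂} {G : Graph n} {A₁ : Graph m₁} {A₂ : Graph m₂} →
                Step G A₁ → Step G A₂ → Joinable A₁ A₂
local-diamond (pendant _ x₁ a₁ _ p₁) (pendant _ x₂ a₂ _ p₂) =
  pendants-joinable p₁ p₂ (Removes-delete-delete x₁ a₁) (Removes-delete-delete x₂ a₂)
local-diamond (pendant G x a z p)  (wholeP2 _ _)        = ⊥-elim (Graph₂-no-pendantP2 G x a z p)
local-diamond (wholeP2 _ _)        (pendant G x a z p)  = ⊥-elim (Graph₂-no-pendantP2 G x a z p)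
local-diamond (wholeP2 _ _)        (wholeP2 _ _)        = isomorphic (Iso-refl {G = emptyGraph})

-- Uniqueness of the residual graph

strip : ∀ {n m k} {G : Graph n} {A : Graph m} {H : Graph k} →
        Step G A → Steps G H → Terminal H → ∃₂ λ k′ (H′ : Graph k′) → Steps A H′ × Iso H H′
strip s (done _) t = ⊥-elim (t _ _ s)
strip {A = A} {H} s (next {H = A₂} s₂ ss) t with local-diamond s s₂
... | isomorphic A≅A₂ = steps-transport (Iso-sym {G = A} {A₂} A≅A₂) ss
... | joined {B₁ = B₁} {B₂} b₁ b₂ B₁≅B₂ with strip b₂ ss t
...   | _ , H′ , ss′ , H≅H′ with steps-transport (Iso-sym {G = B₁} {B₂} B₁≅B₂) ss′
...     | _ , H″ , ss″ , H′≅H″ = _ , H″ , next b₁ ss″ , Iso-trans {G = H} {H′} {H″} H≅H′ H′≅H″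

lemma4p1 : ∀ n (G : Graph n) m₁ (H₁ : Graph m₁) m₂ (H₂ : Graph m₂) →
           Steps G H₁ → Terminal H₁ →
           Steps G H₂ → Terminal H₂ →
           Iso H₁ H₂
lemma4p1 _ G _ _ _ _ (done _) _  (done _)   _  = Iso-refl {G = G}
lemma4p1 _ _ _ _ _ _ (done _) t₁ (next s _) _  = ⊥-elim (t₁ _ _ s)
lemma4p1 _ _ _ H₁ _ H₂ (next s ss₁) t₁ ss₂ t₂ with strip s ss₂ t₂
... | _ , H₂′ , ss₂′ , H₂≅H₂′ =
  Iso-trans {G = H₁} {H₂′} {H₂} (lemma4p1 _ _ _ H₁ _ H₂′ ss₁ t₁ ss₂′ (Terminal-transport H₂≅H₂′ t₂))
                                (Iso-sym {G = H₂} {H₂′} H₂≅H₂′)
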